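{- As formal power series in $t$, $$\sum_{m\ge 1}\frac{\big((m-1)!\big)^2t^{m}}{\prod_{k=1}^m (1+k^2 t)}=t\qquad\text{and}\qquad\sum_{m\ge 1}\frac{m!(m-1)!\,t^{m}}{\prod_{k=1}^m \big(1+k(k+1)t\big)}=t.$$ -}

module Defs where

open import Data.Nat as ℕ using (ℕ; zero; suc; _∸_; _≡ᵇ_)
open import Data.Nat using (_!)
open import Data.Integer using (ℤ; +_; -_; _*_; _+_; _^_)
open import Data.Bool using (if_then_else_)

-- Formal power series in t with integer coefficients: n ↦ coefficient of t^n.
PS : Set
PS = ℕ → ℤ

sumBelow : ℕ → (ℕ → ℤ) → ℤ
sumBelow zero    f = + 0
sumBelow (suc n) f = sumBelow n f + f n

_⊗_ : PS → PS → PS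
(f ⊗ g) n = sumBelow (suc n) (λ i → f i * g (n ∸ i))

infixl 7 _⊗_

scale : ℤ → PS → PS
scale c f n = c * f n

tpow : ℕ → PS
tpow m n = if m ≡ᵇ n then + 1 else + 0

one : PS
one = tpow 0

-- (1 + a t)^{-1} = Σ_j (-a)^j t^j  (the inverse of 1 + a t in ℤ[[t]])
inv1 : ℤ → PS
inv1 a n = (- a) ^ n

-- 1 / ∏_{k=1}^m (1 + c k · t)
prodInv : (ℕ → ℤ) → ℕ → PS
prodInv c zero    = one
prodInv c (suc m) = prodInv c m ⊗ inv1 (c (suc m))

-- Σ_{m ≥ 1} F m, for a family in which F m has t-adic order ≥ m
-- (so the coefficient of t^n only receives contributions from m ≤ n).
sumFrom1 : (ℕ → PS) → PS
sumFrom1 F n = sumBelow n (λ j → F (suc j) n)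

term₁ : ℕ → PS
term₁ m = scale (+ (((m ∸ 1) !) ℕ.* ((m ∸ 1) !)))
                (tpow m ⊗ prodInv (λ k → + (k ℕ.* k)) m)

term₂ : ℕ → PS
term₂ m = scale (+ ((m !) ℕ.* ((m ∸ 1) !)))
                (tpow m ⊗ prodInv (λ k → + (k ℕ.* suc k)) m)

-- With R j := a_{j+1} t^{j+1} / ∏_{k≤j} (1 + c_k t) and a_{j+2} = a_{j+1} c_{j+1}, the identity
-- 1/(1 + c t) = 1 − c t/(1 + c t) shows that the m-th summand is R (m−1) − R m. The series
-- therefore telescopes to R 0 = a_1 t, since R m has t-adic order m + 1 and so contributes
-- nothing to the coefficient of t^n once m ≥ n. Both identities are the case a_1 = 1, with
-- a_m = ((m−1)!)², c_k = k², resp. a_m = m!(m−1)!, c_k = k(k+1).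
module Submission where

open import Defs
open import Data.Nat using (ℕ; zero; suc; _∸_; _<_; _!; s≤s)
import Data.Nat as ℕ
import Data.Nat.Properties as ℕ
open import Data.Nat.Tactic.RingSolver using () renaming (solve-∀ to ℕ-solve-∀)
open import Data.Integer using (ℤ; +_; -_; _*_; _+_; _-_; _^_)
import Data.Integer.Properties as ℤ
open import Data.Integer.Tactic.RingSolver using (solve-∀)
open import Data.Product using (_×_; _,_)
open import Relation.Binary.PropositionalEquality
  using (_≡_; refl; sym; trans; cong; cong₂; module ≡-Reasoning)
open ≡-Reasoning

x-c*0≡x : ∀ x c → x - c * + 0 ≡ x
x-c*0≡x = solve-∀

sumBelow-cong : ∀ n {f g : ℕ → ℤ} → (∀ i → i < n → f i ≡ g i) → sumBelow n f ≡ sumBelow n g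
sumBelow-cong zero    f≡g = refl
sumBelow-cong (suc n) f≡g =
  cong₂ _+_ (sumBelow-cong n (λ i i<n → f≡g i (ℕ.m<n⇒m<1+n i<n))) (f≡g n ℕ.≤-refl)

sumBelow-*ˡ : ∀ n k (f : ℕ → ℤ) → sumBelow n (λ i → k * f i) ≡ k * sumBelow n f
sumBelow-*ˡ zero    k f = sym (ℤ.*-zeroʳ k)
sumBelow-*ˡ (suc n) k f = begin
  sumBelow n (λ i → k * f i) + k * f n ≡⟨ cong (_+ k * f n) (sumBelow-*ˡ n k f) ⟩
  k * sumBelow n f + k * f n           ≡⟨ ℤ.*-distribˡ-+ k (sumBelow n f) (f n) ⟨
  k * (sumBelow n f + f n)             ∎

sumBelow-suc : ∀ n (f : ℕ → ℤ) → sumBelow (suc n) f ≡ f 0 + sumBelow n (λ i → f (suc i))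
sumBelow-suc zero    f = ℤ.+-comm (+ 0) (f 0)
sumBelow-suc (suc n) f = begin
  sumBelow (suc n) f + f (suc n)                        ≡⟨ cong (_+ f (suc n)) (sumBelow-suc n f) ⟩
  f 0 + sumBelow n (λ i → f (suc i)) + f (suc n)        ≡⟨ ℤ.+-assoc (f 0) _ (f (suc n)) ⟩
  f 0 + (sumBelow n (λ i → f (suc i)) + f (suc n))      ∎

sumBelow-telescope : ∀ n (f : ℕ → ℤ) → sumBelow n (λ j → f j - f (suc j)) ≡ f 0 - f n
sumBelow-telescope zero    f = sym (ℤ.+-inverseʳ (f 0))
sumBelow-telescope (suc n) f = begin
  sumBelow n (λ j → f j - f (suc j)) + (f n - f (suc n)) ≡⟨ cong (_+ (f n - f (suc n))) (sumBelow-telescope n f) ⟩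
  (f 0 - f n) + (f n - f (suc n))                        ≡⟨ cancel (f 0) (f n) (f (suc n)) ⟩
  f 0 - f (suc n)                                        ∎
  where
  cancel : ∀ x y z → (x - y) + (y - z) ≡ x - z
  cancel = solve-∀

one-⊗ : ∀ F n → (one ⊗ F) n ≡ F n
one-⊗ F n = begin
  sumBelow (suc n) (λ i → tpow 0 i * F (n ∸ i))
    ≡⟨ sumBelow-suc n _ ⟩
  + 1 * F n + sumBelow n (λ i → + 0 * F (n ∸ suc i))
    ≡⟨ cong₂ _+_ (ℤ.*-identityˡ (F n)) (sumBelow-*ˡ n (+ 0) (λ i → F (n ∸ suc i))) ⟩
  F n + + 0
    ≡⟨ ℤ.+-identityʳ (F n) ⟩
  F n
    ∎

tpow-suc-⊗-zero : ∀ m F → (tpow (suc m) ⊗ F) 0 ≡ + 0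
tpow-suc-⊗-zero m F = refl

tpow-suc-⊗-suc : ∀ m F n → (tpow (suc m) ⊗ F) (suc n) ≡ (tpow m ⊗ F) n
tpow-suc-⊗-suc m F n = trans (sumBelow-suc (suc n) _) (ℤ.+-identityˡ _)

tpow-⊗-< : ∀ m F {n} → n < m → (tpow m ⊗ F) n ≡ + 0
tpow-⊗-< (suc m) F {zero}  _         = tpow-suc-⊗-zero m F
tpow-⊗-< (suc m) F {suc n} (s≤s n<m) = trans (tpow-suc-⊗-suc m F n) (tpow-⊗-< m F n<m)

tpow-⊗-tpow : ∀ m k n → (tpow m ⊗ tpow k) n ≡ tpow (m ℕ.+ k) n
tpow-⊗-tpow zero    k n       = one-⊗ (tpow k) n
tpow-⊗-tpow (suc m) k zero    = tpow-suc-⊗-zero m (tpow k)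
tpow-⊗-tpow (suc m) k (suc n) = trans (tpow-suc-⊗-suc m (tpow k) n) (tpow-⊗-tpow m k n)

⊗-inv1-zero : ∀ F c → (F ⊗ inv1 c) 0 ≡ F 0
⊗-inv1-zero F c = trans (ℤ.+-identityˡ _) (ℤ.*-identityʳ (F 0))

⊗-inv1-suc : ∀ F c n → (F ⊗ inv1 c) (suc n) ≡ F (suc n) - c * (F ⊗ inv1 c) n
⊗-inv1-suc F c n = begin
  sumBelow (suc n) (λ i → F i * (- c) ^ (suc n ∸ i)) + F (suc n) * (- c) ^ (suc n ∸ suc n)
    ≡⟨ cong₂ _+_ lower-terms (cong (λ e → F (suc n) * (- c) ^ e) (ℕ.n∸n≡0 n)) ⟩
  - c * (F ⊗ inv1 c) n + F (suc n) * + 1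
    ≡⟨ rearrange c ((F ⊗ inv1 c) n) (F (suc n)) ⟩
  F (suc n) - c * (F ⊗ inv1 c) n
    ∎
  where
  rearrange : ∀ c g f → - c * g + f * + 1 ≡ f - c * g
  rearrange = solve-∀

  pull-out : ∀ x y z → x * (y * z) ≡ y * (x * z)
  pull-out = solve-∀

  lower-terms : sumBelow (suc n) (λ i → F i * (- c) ^ (suc n ∸ i)) ≡ - c * (F ⊗ inv1 c) n
  lower-terms = begin
    sumBelow (suc n) (λ i → F i * (- c) ^ (suc n ∸ i))
      ≡⟨ sumBelow-cong (suc n) (λ i i≤n → trans
           (cong (λ e → F i * (- c) ^ e) (ℕ.+-∸-assoc 1 (ℕ.≤-pred i≤n)))
           (pull-out (F i) (- c) ((- c) ^ (n ∸ i)))) ⟩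
    sumBelow (suc n) (λ i → - c * (F i * (- c) ^ (n ∸ i)))
      ≡⟨ sumBelow-*ˡ (suc n) (- c) _ ⟩
    - c * (F ⊗ inv1 c) n
      ∎

tpow-⊗-inv1 : ∀ m F c n →
  (tpow m ⊗ (F ⊗ inv1 c)) n ≡ (tpow m ⊗ F) n - c * (tpow (suc m) ⊗ (F ⊗ inv1 c)) n
tpow-⊗-inv1 zero F c zero = begin
  (one ⊗ (F ⊗ inv1 c)) 0 ≡⟨ trans (one-⊗ (F ⊗ inv1 c) 0) (⊗-inv1-zero F c) ⟩
  F 0                    ≡⟨ x-c*0≡x (F 0) c ⟨
  F 0 - c * + 0          ≡⟨ cong₂ (λ x y → x - c * y) (one-⊗ F 0) (tpow-suc-⊗-zero 0 (F ⊗ inv1 c)) ⟨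
  (one ⊗ F) 0 - c * (tpow 1 ⊗ (F ⊗ inv1 c)) 0 ∎
tpow-⊗-inv1 zero F c (suc n) = begin
  (one ⊗ (F ⊗ inv1 c)) (suc n)           ≡⟨ trans (one-⊗ (F ⊗ inv1 c) (suc n)) (⊗-inv1-suc F c n) ⟩
  F (suc n) - c * (F ⊗ inv1 c) n         ≡⟨ cong₂ (λ x y → x - c * y) (one-⊗ F (suc n))
                                              (trans (tpow-suc-⊗-suc 0 (F ⊗ inv1 c) n) (one-⊗ (F ⊗ inv1 c) n)) ⟨
  (one ⊗ F) (suc n) - c * (tpow 1 ⊗ (F ⊗ inv1 c)) (suc n) ∎
tpow-⊗-inv1 (suc m) F c zero = sym (x-c*0≡x (+ 0) c)
tpow-⊗-inv1 (suc m) F c (suc n) = begin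
  (tpow (suc m) ⊗ (F ⊗ inv1 c)) (suc n)  ≡⟨ tpow-suc-⊗-suc m (F ⊗ inv1 c) n ⟩
  (tpow m ⊗ (F ⊗ inv1 c)) n              ≡⟨ tpow-⊗-inv1 m F c n ⟩
  (tpow m ⊗ F) n - c * (tpow (suc m) ⊗ (F ⊗ inv1 c)) n
    ≡⟨ cong₂ (λ x y → x - c * y) (tpow-suc-⊗-suc m F n) (tpow-suc-⊗-suc (suc m) (F ⊗ inv1 c) n) ⟨
  (tpow (suc m) ⊗ F) (suc n) - c * (tpow (suc (suc m)) ⊗ (F ⊗ inv1 c)) (suc n) ∎

module _ (a c : ℕ → ℤ) where

  term : ℕ → PS
  term m = scale (a m) (tpow m ⊗ prodInv c m)

  remainder : ℕ → PS
  remainder j = scale (a (suc j)) (tpow (suc j) ⊗ prodInv c j)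

  module _ (a-rec : ∀ m → a (suc (suc m)) ≡ a (suc m) * c (suc m)) where

    term≡remainder-difference : ∀ j n → term (suc j) n ≡ remainder j n - remainder (suc j) n
    term≡remainder-difference j n = begin
      a (suc j) * (tpow (suc j) ⊗ (P ⊗ inv1 c′)) n
        ≡⟨ cong (a (suc j) *_) (tpow-⊗-inv1 (suc j) P c′ n) ⟩
      a (suc j) * ((tpow (suc j) ⊗ P) n - c′ * (tpow (suc (suc j)) ⊗ P′) n)
        ≡⟨ distribute (a (suc j)) c′ _ _ ⟩
      a (suc j) * (tpow (suc j) ⊗ P) n - a (suc j) * c′ * (tpow (suc (suc j)) ⊗ P′) n
        ≡⟨ cong (λ x → remainder j n - x * (tpow (suc (suc j)) ⊗ P′) n) (a-rec j) ⟨
      remainder j n - remainder (suc j) n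
        ∎
      where
      P = prodInv c j
      c′ = c (suc j)
      P′ = prodInv c (suc j)

      distribute : ∀ x y u v → x * (u - y * v) ≡ x * u - x * y * v
      distribute = solve-∀

    sumFrom1-term : ∀ n → sumFrom1 term n ≡ a 1 * tpow 1 n
    sumFrom1-term n = begin
      sumBelow n (λ j → term (suc j) n)
        ≡⟨ sumBelow-cong n (λ j _ → term≡remainder-difference j n) ⟩
      sumBelow n (λ j → remainder j n - remainder (suc j) n)
        ≡⟨ sumBelow-telescope n (λ j → remainder j n) ⟩
      remainder 0 n - a (suc n) * (tpow (suc n) ⊗ prodInv c n) n
        ≡⟨ cong₂ (λ x y → x - a (suc n) * y) (cong (a 1 *_) (tpow-⊗-tpow 1 0 n))
                                              (tpow-⊗-< (suc n) (prodInv c n) ℕ.≤-refl) ⟩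
      a 1 * tpow 1 n - a (suc n) * + 0
        ≡⟨ x-c*0≡x (a 1 * tpow 1 n) (a (suc n)) ⟩
      a 1 * tpow 1 n
        ∎

factorial²-suc : ∀ j → + (suc j ! ℕ.* suc j !) ≡ + (j ! ℕ.* j !) * + (suc j ℕ.* suc j)
factorial²-suc j =
  trans (cong +_ (identity (suc j) (j !))) (ℤ.pos-* (j ! ℕ.* j !) (suc j ℕ.* suc j))
  where
  identity : ∀ k f → (k ℕ.* f) ℕ.* (k ℕ.* f) ≡ (f ℕ.* f) ℕ.* (k ℕ.* k)
  identity = ℕ-solve-∀

factorial-*-factorial-suc :
  ∀ j → + (suc (suc j) ! ℕ.* suc j !) ≡ + (suc j ! ℕ.* j !) * + (suc j ℕ.* suc (suc j))
factorial-*-factorial-suc j =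
  trans (cong +_ (identity (suc j) (j !))) (ℤ.pos-* (suc j ! ℕ.* j !) (suc j ℕ.* suc (suc j)))
  where
  identity : ∀ k f → ((1 ℕ.+ k) ℕ.* (k ℕ.* f)) ℕ.* (k ℕ.* f) ≡ ((k ℕ.* f) ℕ.* f) ℕ.* (k ℕ.* (1 ℕ.+ k))
  identity = ℕ-solve-∀

sumFrom1-term-monic : ∀ a c → a 1 ≡ + 1 → (∀ m → a (suc (suc m)) ≡ a (suc m) * c (suc m)) →
                      ∀ n → sumFrom1 (term a c) n ≡ tpow 1 n
sumFrom1-term-monic a c a₁≡1 a-rec n = begin
  sumFrom1 (term a c) n ≡⟨ sumFrom1-term a c a-rec n ⟩
  a 1 * tpow 1 n        ≡⟨ cong (_* tpow 1 n) a₁≡1 ⟩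
  + 1 * tpow 1 n        ≡⟨ ℤ.*-identityˡ (tpow 1 n) ⟩
  tpow 1 n              ∎

corollary5p1 : ((n : ℕ) → sumFrom1 term₁ n ≡ tpow 1 n) × ((n : ℕ) → sumFrom1 term₂ n ≡ tpow 1 n)
corollary5p1 =
  sumFrom1-term-monic (λ m → + ((m ∸ 1) ! ℕ.* (m ∸ 1) !)) (λ k → + (k ℕ.* k)) refl factorial²-suc ,
  sumFrom1-term-monic (λ m → + (m ! ℕ.* (m ∸ 1) !)) (λ k → + (k ℕ.* suc k)) refl factorial-*-factorial-suc
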